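{- Let $B$ be a red–blue Hackenbush position with normal-play value $0$, and let $n\ge 1$. Then $*_n:B=^- *_n$, i.e. $o^-(*_n:B+X)=o^-(*_n+X)$ for every game $X$.
   Context: Red–blue Hackenbush positions have only red and blue edges (Left cuts blue, Right cuts red) and have a normal-play value (a dyadic rational). $*_n$ is the nim-heap of size $n$ (a green path of $n$ edges on the ground). The ordinal sum is $G:H=\{G^L, G:H^L\mid G^R, G:H^R\}$; in Hackenbush, $*_n:B$ is the green path of length $n$ on the ground with $B$ attached at its top vertex. Under misère play the last player to move loses; $o^-$ is the misère outcome class. -}

module Defs where

open import Data.Nat using (ℕ; zero; suc; _+_; _≡ᵇ_)
open import Data.Fin using (Fin; zero; suc; splitAt)
open import Data.Bool using (Bool; true; false; _∨_; _∧_; not; if_then_else_)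
open import Data.Sum using ([_,_]′)
open import Data.Product using (_×_; _,_)
open import Data.List using (List; []; _∷_; length; map; lookup; allFin; removeAt; _++_)

data Game : Set where
  game : (nL : ℕ) → (Fin nL → Game) → (nR : ℕ) → (Fin nR → Game) → Game

⟨_∣_⟩ : List Game → List Game → Game
⟨ l ∣ r ⟩ = game (length l) (lookup l) (length r) (lookup r)

infixl 6 _⊕_
_⊕_ : Game → Game → Game
G@(game a f b g) ⊕ H@(game c h d k) =
  game (a + c) (λ i → [ (λ x → f x ⊕ H) , (λ y → G ⊕ h y) ]′ (splitAt a i))
       (b + d) (λ i → [ (λ x → g x ⊕ H) , (λ y → G ⊕ k y) ]′ (splitAt b i))

infixl 7 _∶_
_∶_ : Game → Game → Game
G@(game a f b g) ∶ game c h d k =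
  game (a + c) (λ i → [ f , (λ y → G ∶ h y) ]′ (splitAt a i))
       (b + d) (λ i → [ g , (λ y → G ∶ k y) ]′ (splitAt b i))

-- nim heaps: starOpts n enumerates *_{n-1}, ..., *_0
starOpts : (n : ℕ) → Fin n → Game
starOpts (suc n) zero    = game n (starOpts n) n (starOpts n)
starOpts (suc n) (suc i) = starOpts n i

* : ℕ → Game
* n = game n (starOpts n) n (starOpts n)

anyFin : (n : ℕ) → (Fin n → Bool) → Bool
anyFin zero    p = false
anyFin (suc n) p = p zero ∨ anyFin n (λ i → p (suc i))

isZero : ℕ → Bool
isZero zero    = true
isZero (suc _) = false

mutual
  nLeftFirst : Game → Bool
  nLeftFirst (game a f b g) = anyFin a (λ i → not (nRightFirst (f i)))

  nRightFirst : Game → Bool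
  nRightFirst (game a f b g) = anyFin b (λ j → not (nLeftFirst (g j)))

-- normal-play value 0:  G = 0  iff  G is a previous-player win (P-position)
NormalZero : Game → Set
NormalZero G = (nLeftFirst G ≡ false) × (nRightFirst G ≡ false)
  where open import Relation.Binary.PropositionalEquality using (_≡_)

mutual
  misLeftFirst : Game → Bool
  misLeftFirst (game a f b g) = isZero a ∨ anyFin a (λ i → not (misRightFirst (f i)))

  misRightFirst : Game → Bool
  misRightFirst (game a f b g) = isZero b ∨ anyFin b (λ j → not (misLeftFirst (g j)))

data Outcome : Set where
  𝓛 𝓝 𝓟 𝓡 : Outcome

outcomeOf : Bool → Bool → Outcome
outcomeOf true  false = 𝓛
outcomeOf true  true  = 𝓝
outcomeOf false false = 𝓟
outcomeOf false true  = 𝓡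

o⁻ : Game → Outcome
o⁻ G = outcomeOf (misLeftFirst G) (misRightFirst G)

-- Red–blue Hackenbush.
-- Vertices are natural numbers; vertex 0 is the ground (all ground
-- vertices identified).  An edge is a colour with its two endpoints
-- (loops and multiple edges allowed).

data Colour : Set where
  red blue : Colour

record Edge : Set where
  constructor edge
  field
    colour : Colour
    end₁   : ℕ
    end₂   : ℕ
open Edge public

RBHackenbush : Set
RBHackenbush = List Edge

isColour : Colour → Edge → Bool
isColour red  (edge red  _ _) = true
isColour blue (edge blue _ _) = true
isColour _    _               = false

bfilter : {A : Set} → (A → Bool) → List A → List A
bfilter p []       = []
bfilter p (x ∷ xs) = if p x then x ∷ bfilter p xs else bfilter p xs

elemℕ : ℕ → List ℕ → Bool
elemℕ x []       = false
elemℕ x (y ∷ ys) = (x ≡ᵇ y) ∨ elemℕ x ys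

touches : List ℕ → Edge → Bool
touches S (edge _ u v) = elemℕ u S ∨ elemℕ v S

grow : List Edge → List ℕ → List ℕ
grow []                 S = S
grow (edge c u v ∷ es) S = if touches S (edge c u v) then u ∷ v ∷ grow es S else grow es S

iterate : ℕ → (List ℕ → List ℕ) → List ℕ → List ℕ
iterate zero    f S = S
iterate (suc k) f S = iterate k f (f S)

-- vertices connected to the ground (|edges| growth steps suffice)
grounded : List Edge → List ℕ
grounded es = iterate (length es) (grow es) (0 ∷ [])

prune : List Edge → List Edge
prune es = bfilter (touches (grounded es)) es

-- the game tree of a position, with fuel (a move removes ≥ 1 edge, so
-- fuel = number of edges is enough).  Left cuts blue, Right cuts red.
hackFuel : ℕ → List Edge → Game
hackFuel zero    es = game 0 (λ ()) 0 (λ ())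
hackFuel (suc k) es = ⟨ moves blue ∣ moves red ⟩
  where
  moves : Colour → List Game
  moves c = map (λ i → hackFuel k (prune (removeAt es i)))
                (bfilter (λ i → isColour c (lookup es i)) (allFin (length es)))

hackenbush : RBHackenbush → Game
hackenbush es = hackFuel (length es) (prune es)

module Submission where

-- Nothing about Hackenbush is needed: for ANY game B whose
-- normal-play value is 0 and ANY game G in which both players have a move,
-- G : B is misère-equivalent to G, i.e.  o⁻ (G : B + X) = o⁻ (G + X)  for
-- all X; the corollary is the case G = *_n with n ≥ 1.
--
-- Fix a player p and suppose B ≥ 0 from p's viewpoint (the opponent, moving
-- first, loses B under normal play).  By induction on X, and inside that on
-- B, adding B on top of G
--   * preserves p's misère win when p moves first, and
--   * preserves the opponent's misère loss when the opponent moves first.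
-- A move inside G answers a move inside G (G always offers one, so having no
-- move never decides these games); a move in X is answered by induction; and
-- an opponent's move from B to B' is answered by p's normal-play winning
-- reply B' → B'', which restores B'' ≥ 0.  Applying this to both players
-- gives equal misère outcomes when B = 0.

open import Defs
open import Data.Nat using (ℕ; _≥_; zero; suc; _+_; s≤s)
open import Data.Fin using (Fin; zero; suc; splitAt; _↑ˡ_; _↑ʳ_)
open import Data.Fin.Properties using (splitAt-↑ˡ; splitAt-↑ʳ)
open import Data.Bool using (Bool; true; false; _∨_; not)
open import Data.Bool.Properties using (∨-zeroʳ; not-injective; not-¬; ¬-not)
open import Data.Sum using (_⊎_; inj₁; inj₂; [_,_]′)
import Data.Sum as Sum
open import Data.Product using (Σ; ∃; _×_; _,_; proj₁; proj₂)
open import Data.Empty using (⊥)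
open import Relation.Binary.PropositionalEquality using (_≡_; refl; sym; trans; cong; cong₂; module ≡-Reasoning)

data Player : Set where
  Left Right : Player

moves : Player → Game → ℕ
moves Left  (game a f b g) = a
moves Right (game a f b g) = b

option : (p : Player) (G : Game) → Fin (moves p G) → Game
option Left  (game a f b g) = f
option Right (game a f b g) = g

misWins : Player → Game → Bool
misWins Left  = misLeftFirst
misWins Right = misRightFirst

norWins : Player → Game → Bool
norWins Left  = nLeftFirst
norWins Right = nRightFirst

OneOf : {n : ℕ} → (Fin n → Game) → Game → Set
OneOf {n} f H = Σ (Fin n) λ i → f i ≡ H

-- H is a p-option of G.  (A record rather than a synonym for
-- OneOf (option p G) H, so that p and G can be inferred from it.)
record Option (p : Player) (G H : Game) : Set where
  constructor via
  field
    member : OneOf (option p G) H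

game-ind : (P : Game → Set) → (∀ G → (∀ {p H} → Option p G H → P H) → P G) → ∀ G → P G
game-ind P step G@(game a f b g) = step G (λ {p} {H} → ih {p} {H})
  where
  ih : ∀ {p H} → Option p G H → P H
  ih {Left}  (via (i , refl)) = game-ind P step (f i)
  ih {Right} (via (j , refl)) = game-ind P step (g j)

someOption : Player → Game → (Game → Bool) → Bool
someOption p G test = anyFin (moves p G) (λ i → test (option p G i))

anyFin-intro : ∀ n (test : Fin n → Bool) i → test i ≡ true → anyFin n test ≡ true
anyFin-intro (suc n) test zero    hit = cong (_∨ anyFin n (λ j → test (suc j))) hit
anyFin-intro (suc n) test (suc i) hit =
  trans (cong (test zero ∨_) (anyFin-intro n (λ j → test (suc j)) i hit)) (∨-zeroʳ (test zero))

anyFin-elim : ∀ n (test : Fin n → Bool) → anyFin n test ≡ true → Σ (Fin n) λ i → test i ≡ true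
anyFin-elim (suc n) test found with test zero in hit
... | true  = zero , hit
... | false with anyFin-elim n (λ j → test (suc j)) found
...   | i , hit′ = suc i , hit′

someOption-intro : ∀ {p G H} (test : Game → Bool) → Option p G H → test H ≡ true →
                   someOption p G test ≡ true
someOption-intro {p} {G} test (via (i , refl)) hit = anyFin-intro (moves p G) _ i hit

someOption-elim : ∀ p G (test : Game → Bool) → someOption p G test ≡ true →
                  ∃ λ H → Option p G H × test H ≡ true
someOption-elim p G test found with anyFin-elim (moves p G) _ found
... | i , hit = option p G i , via (i , refl) , hit

-- The two players p, q are opponents of each other.  Carrying this as a
-- relation (instead of q = opponent p) keeps both directions definitional.
data Opposed : Player → Player → Set where
  left-right : Opposed Left Right
  right-left : Opposed Right Left

flip : ∀ {p q} → Opposed p q → Opposed q p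
flip left-right = right-left
flip right-left = left-right

misWins-unfold : ∀ {p q} → Opposed p q → ∀ G →
  misWins p G ≡ isZero (moves p G) ∨ someOption p G (λ H → not (misWins q H))
misWins-unfold left-right (game a f b g) = refl
misWins-unfold right-left (game a f b g) = refl

norWins-unfold : ∀ {p q} → Opposed p q → ∀ G → norWins p G ≡ someOption p G (λ H → not (norWins q H))
norWins-unfold left-right (game a f b g) = refl
norWins-unfold right-left (game a f b g) = refl

misWins-by : ∀ {p q G H} → Opposed p q → Option p G H → misWins q H ≡ false → misWins p G ≡ true
misWins-by {p} {q} {G} pq o lost = begin
  misWins p G                                                          ≡⟨ misWins-unfold pq G ⟩
  isZero (moves p G) ∨ someOption p G (λ H → not (misWins q H))        ≡⟨ cong (isZero (moves p G) ∨_) found ⟩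
  isZero (moves p G) ∨ true                                            ≡⟨ ∨-zeroʳ _ ⟩
  true                                                                 ∎
  where
  open ≡-Reasoning
  found : someOption p G (λ H → not (misWins q H)) ≡ true
  found = someOption-intro (λ H → not (misWins q H)) o (cong not lost)

has-move-∨ : ∀ {n} → Fin n → (b : Bool) → isZero n ∨ b ≡ b
has-move-∨ zero    b = refl
has-move-∨ (suc _) b = refl

misWins-move : ∀ {p q G H₀} → Opposed p q → Option p G H₀ → misWins p G ≡ true →
               ∃ λ H → Option p G H × misWins q H ≡ false
misWins-move {p} {G = G} pq (via (i₀ , _)) win
  with someOption-elim p G _ (trans (sym (has-move-∨ i₀ _)) (trans (sym (misWins-unfold pq G)) win))
... | H , o , notLost = H , o , not-injective notLost

norWins-move : ∀ {p q G} → Opposed p q → norWins p G ≡ true → ∃ λ H → Option p G H × norWins q H ≡ false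
norWins-move {p} {G = G} pq win with someOption-elim p G _ (trans (sym (norWins-unfold pq G)) win)
... | H , o , notWon = H , o , not-injective notWon

norWins-reply : ∀ {p q G H} → Opposed p q → norWins p G ≡ false → Option p G H → norWins q H ≡ true
norWins-reply {q = q} {G} pq lost o = ¬-not λ Hlost →
  not-¬ (trans (norWins-unfold pq G) (someOption-intro (λ H → not (norWins q H)) o (cong not Hlost))) lost

bool-ext : ∀ {x y : Bool} → (y ≡ true → x ≡ true) → (y ≡ false → x ≡ false) → x ≡ y
bool-ext {y = true}  t f = t refl
bool-ext {y = false} t f = f refl

false-reflected : ∀ {x y : Bool} → (x ≡ true → y ≡ true) → y ≡ false → x ≡ false
false-reflected x⇒y y-false = ¬-not λ x-true → not-¬ (x⇒y x-true) y-false

join : ∀ {a c} → (Fin a → Game) → (Fin c → Game) → Fin (a + c) → Game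
join {a} u v i = [ u , v ]′ (splitAt a i)

oneOf-joinˡ : ∀ {a c} {u : Fin a → Game} (v : Fin c → Game) {H} → OneOf u H → OneOf (join u v) H
oneOf-joinˡ {c = c} {u} v (x , refl) = x ↑ˡ c , cong [ u , v ]′ (splitAt-↑ˡ _ x c)

oneOf-joinʳ : ∀ {a c} (u : Fin a → Game) {v : Fin c → Game} {H} → OneOf v H → OneOf (join u v) H
oneOf-joinʳ {a} {c} u {v} (y , refl) = a ↑ʳ y , cong [ u , v ]′ (splitAt-↑ʳ a c y)

oneOf-split : ∀ {a c} (u : Fin a → Game) (v : Fin c → Game) {H} → OneOf (join u v) H → OneOf u H ⊎ OneOf v H
oneOf-split {a} u v (i , refl) with splitAt a i
... | inj₁ x = inj₁ (x , refl)
... | inj₂ y = inj₂ (y , refl)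

oneOf-map : ∀ {n} {f : Fin n → Game} (F : Game → Game) {H} → OneOf f H → OneOf (λ i → F (f i)) (F H)
oneOf-map F (i , refl) = i , refl

oneOf-image : ∀ {p G} (F : Game → Game) {H} → OneOf (λ i → F (option p G i)) H →
              ∃ λ H' → Option p G H' × F H' ≡ H
oneOf-image {p} {G} F (i , refl) = option p G i , via (i , refl) , refl

⊕-option-left : ∀ {p G G'} X → Option p G G' → Option p (G ⊕ X) (G' ⊕ X)
⊕-option-left {Left}  {game a f b g} X@(game c h d k) (via o) = via (oneOf-joinˡ _ (oneOf-map (_⊕ X) o))
⊕-option-left {Right} {game a f b g} X@(game c h d k) (via o) = via (oneOf-joinˡ _ (oneOf-map (_⊕ X) o))

⊕-option-right : ∀ {p X X'} G → Option p X X' → Option p (G ⊕ X) (G ⊕ X')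
⊕-option-right {Left}  {game c h d k} G@(game a f b g) (via o) = via (oneOf-joinʳ _ (oneOf-map (G ⊕_) o))
⊕-option-right {Right} {game c h d k} G@(game a f b g) (via o) = via (oneOf-joinʳ _ (oneOf-map (G ⊕_) o))

⊕-option-cases : ∀ {p} G X {H} → Option p (G ⊕ X) H →
  (∃ λ G' → Option p G G' × G' ⊕ X ≡ H) ⊎ (∃ λ X' → Option p X X' × G ⊕ X' ≡ H)
⊕-option-cases {Left} G@(game a f b g) X@(game c h d k) (via o) =
  Sum.map (oneOf-image (_⊕ X)) (oneOf-image (G ⊕_)) (oneOf-split _ _ o)
⊕-option-cases {Right} G@(game a f b g) X@(game c h d k) (via o) =
  Sum.map (oneOf-image (_⊕ X)) (oneOf-image (G ⊕_)) (oneOf-split _ _ o)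

∶-option-base : ∀ {p G G'} B → Option p G G' → Option p (G ∶ B) G'
∶-option-base {Left}  {game a f b g} (game c h d k) (via o) = via (oneOf-joinˡ _ o)
∶-option-base {Right} {game a f b g} (game c h d k) (via o) = via (oneOf-joinˡ _ o)

∶-option-top : ∀ {p B B'} G → Option p B B' → Option p (G ∶ B) (G ∶ B')
∶-option-top {Left}  {game c h d k} G@(game a f b g) (via o) = via (oneOf-joinʳ _ (oneOf-map (G ∶_) o))
∶-option-top {Right} {game c h d k} G@(game a f b g) (via o) = via (oneOf-joinʳ _ (oneOf-map (G ∶_) o))

∶-option-cases : ∀ {p} G B {H} → Option p (G ∶ B) H →
  Option p G H ⊎ (∃ λ B' → Option p B B' × G ∶ B' ≡ H)
∶-option-cases {Left}  G@(game a f b g) (game c h d k) (via o) =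
  Sum.map via (oneOf-image (G ∶_)) (oneOf-split _ _ o)
∶-option-cases {Right} G@(game a f b g) (game c h d k) (via o) =
  Sum.map via (oneOf-image (G ∶_)) (oneOf-split _ _ o)

-- The absorption lemma, for a base G in which both players have a move and a
-- fixed player p with opponent q.  B "favours" p if q, moving first, loses B
-- under normal play (B ≥ 0 from p's side).

module Absorption (G : Game) (G-moves : ∀ p → ∃ (Option p G)) {p q : Player} (pq : Opposed p q) where

  qp : Opposed q p
  qp = flip pq

  Favours : Game → Set
  Favours B = norWins q B ≡ false

  PreservesWin : Game → Set
  PreservesWin X = ∀ B → Favours B → misWins p (G ⊕ X) ≡ true → misWins p (G ∶ B ⊕ X) ≡ true

  PreservesLoss : Game → Set
  PreservesLoss X = ∀ B → Favours B → misWins q (G ⊕ X) ≡ false → misWins q (G ∶ B ⊕ X) ≡ false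

  -- p wins first by copying a winning move: a move inside G stays available,
  -- and after a move X → X' the opponent's loss persists by induction.
  win-preserved : ∀ X → (∀ {X'} → Option p X X' → PreservesLoss X') → PreservesWin X
  win-preserved X loss-ih B favB win
    with misWins-move pq (⊕-option-left X (proj₂ (G-moves p))) win
  ... | H , o , lost with ⊕-option-cases G X o
  ...   | inj₁ (G' , oG , refl) = misWins-by pq (⊕-option-left X (∶-option-base B oG)) lost
  ...   | inj₂ (X' , oX , refl) = misWins-by pq (⊕-option-right (G ∶ B) oX) (loss-ih oX B favB lost)

  -- By induction on B: the opponent loses G : B + X moving first when B
  -- favours p, and p wins G : B + X moving first when p wins B moving first
  -- under normal play (p then moves in B to a position favouring p).
  loss-preserved : ∀ X → (∀ {X'} → Option q X X' → PreservesWin X') → PreservesLoss X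
  loss-preserved X win-ih B favB Xlost = proj₁ (game-ind Claim step B) favB
    where
    Claim : Game → Set
    Claim B = (Favours B → misWins q (G ∶ B ⊕ X) ≡ false)
            × (norWins p B ≡ true → misWins p (G ∶ B ⊕ X) ≡ true)

    step : ∀ B → (∀ {r H} → Option r B H → Claim H) → Claim B
    step B ih = opponent-loses , p-wins
      where
      p-wins : norWins p B ≡ true → misWins p (G ∶ B ⊕ X) ≡ true
      p-wins Bwon with norWins-move pq Bwon
      ... | B' , oB , favB' =
        misWins-by pq (⊕-option-left X (∶-option-top G oB)) (proj₁ (ih oB) favB')

      -- every winning misère reply of the opponent would contradict an
      -- induction hypothesis or the assumed loss in G + X
      refute : Favours B → misWins q (G ∶ B ⊕ X) ≡ true → ⊥
      refute favB win with misWins-move qp (⊕-option-left X (∶-option-base B (proj₂ (G-moves q)))) win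
      ... | H , o , lost with ⊕-option-cases (G ∶ B) X o
      ...   | inj₂ (X' , oX , refl) =
        not-¬ (misWins-by qp (⊕-option-right G oX) (false-reflected (win-ih oX B favB) lost)) Xlost
      ...   | inj₁ (C , oC , refl) with ∶-option-cases G B oC
      ...     | inj₁ oG                = not-¬ (misWins-by qp (⊕-option-left X oG) lost) Xlost
      ...     | inj₂ (B' , oB , refl) = not-¬ (proj₂ (ih oB) (norWins-reply qp favB oB)) lost

      opponent-loses : Favours B → misWins q (G ∶ B ⊕ X) ≡ false
      opponent-loses favB = ¬-not (refute favB)

  absorbs : ∀ X → PreservesWin X × PreservesLoss X
  absorbs = game-ind _ λ X ih →
    win-preserved X (λ o → proj₂ (ih o)) , loss-preserved X (λ o → proj₁ (ih o))

ordinal-sum-absorbs-zero : ∀ G → (∀ p → ∃ (Option p G)) → ∀ B → NormalZero B →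
                           ∀ X → o⁻ (G ∶ B ⊕ X) ≡ o⁻ (G ⊕ X)
ordinal-sum-absorbs-zero G G-moves B (leftLoses , rightLoses) X =
  cong₂ outcomeOf (same-result left-right) (same-result right-left)
  where
  favours : ∀ p → norWins p B ≡ false
  favours Left  = leftLoses
  favours Right = rightLoses

  same-result : ∀ {p q} → Opposed p q → misWins p (G ∶ B ⊕ X) ≡ misWins p (G ⊕ X)
  same-result {p} {q} pq =
    bool-ext (proj₁ (forP.absorbs X) B (favours q)) (proj₂ (forQ.absorbs X) B (favours p))
    where
    module forP = Absorption G G-moves pq
    module forQ = Absorption G G-moves (flip pq)

star-moves : ∀ m p → ∃ (Option p (* (suc m)))
star-moves m Left  = * m , via (zero , refl)
star-moves m Right = * m , via (zero , refl)

corollary4p4 : (B : RBHackenbush) → NormalZero (hackenbush B) → (n : ℕ) → n ≥ 1 →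
    (X : Game) → o⁻ (* n ∶ hackenbush B ⊕ X) ≡ o⁻ (* n ⊕ X)
corollary4p4 B B≡0 (suc m) (s≤s _) X =
  ordinal-sum-absorbs-zero (* (suc m)) (star-moves m) (hackenbush B) B≡0 X
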